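{- Let $\mathcal{A}$ be a finite alphabet, let $w\in\mathcal{A}^+$ with $|\mathrm{Alph}(w)|>1$, and let $u$ be a finite word over $\mathcal{A}$ such that for every acceptable pair $(a,<)$, letting $m=\min(w)$ with respect to $<$, we have $|u|\ge|m|-1$ and $a\,u_{|m|-1}\le m$ (where $u_p$ is the prefix of length $p$ of $u$). Then $u$ is non-empty and its first letter is separating for $w$, i.e., every factor of $w$ of length $2$ contains that letter.
   Context: $\mathrm{Alph}(w)$ is the set of letters occurring in $w$. An acceptable pair $(a,<)$ consists of a letter $a\in\mathcal{A}$ and a total order $<$ on $\mathcal{A}$ with $a=\min(\mathcal{A})$, extended to words lexicographically: $u<v$ iff $u$ is a proper prefix of $v$, or $u=xau'$, $v=xbv'$ with letters $a<b$. For $k\le|w|$, $\min(w|k)$ is the lexicographically smallest factor of $w$ of length $k$, and $\min(w)$ is $\min(w|k)$ for the maximal $k$ such that all $\min(w|j)$, $j=1,\dots,k$, are prefixes of $\min(w|k)$. -}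

module Defs where

open import Data.Nat using (ℕ; _≤_; _∸_)
open import Data.Fin using (Fin)
open import Data.List using (List; []; _∷_; _++_; length; take)
open import Data.List.Membership.Propositional using (_∈_)
open import Data.Product using (Σ; ∃; _×_; _,_)
open import Data.Sum using (_⊎_)
open import Relation.Binary.PropositionalEquality using (_≡_; _≢_)
open import Relation.Binary.Structures using (IsStrictTotalOrder)

Word : ℕ → Set
Word n = List (Fin n)

data LexLt {n : ℕ} (_<_ : Fin n → Fin n → Set) : Word n → Word n → Set where
  halt : ∀ {b v} → LexLt _<_ [] (b ∷ v)
  this : ∀ {a b u v} → a < b → LexLt _<_ (a ∷ u) (b ∷ v)
  next : ∀ {a u v} → LexLt _<_ u v → LexLt _<_ (a ∷ u) (a ∷ v)

LexLe : {n : ℕ} → (Fin n → Fin n → Set) → Word n → Word n → Set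
LexLe _<_ u v = LexLt _<_ u v ⊎ u ≡ v

Factor : {n : ℕ} → Word n → Word n → Set
Factor x w = Σ _ λ p → Σ _ λ s → w ≡ p ++ (x ++ s)

Prefix : {n : ℕ} → Word n → Word n → Set
Prefix p m = Σ _ λ s → m ≡ p ++ s

IsMinFactor : {n : ℕ} → (Fin n → Fin n → Set) → Word n → ℕ → Word n → Set
IsMinFactor _<_ w k x =
  length x ≡ k × Factor x w ×
  (∀ y → length y ≡ k → Factor y w → LexLe _<_ x y)

GoodLength : {n : ℕ} → (Fin n → Fin n → Set) → Word n → ℕ → Word n → Set
GoodLength _<_ w k m =
  IsMinFactor _<_ w k m ×
  (∀ j x → 1 ≤ j → j ≤ k → IsMinFactor _<_ w j x → Prefix x m)

IsMinWord : {n : ℕ} → (Fin n → Fin n → Set) → Word n → Word n → Set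
IsMinWord _<_ w m =
  Σ ℕ λ k → k ≤ length w × GoodLength _<_ w k m ×
  (∀ k' m' → k' ≤ length w → GoodLength _<_ w k' m' → k' ≤ k)

Acceptable : {n : ℕ} → Fin n → (Fin n → Fin n → Set) → Set
Acceptable a _<_ = IsStrictTotalOrder _≡_ _<_ × (∀ b → a ≢ b → a < b)

AlphGt1 : {n : ℕ} → Word n → Set
AlphGt1 w = Σ _ λ a → Σ _ λ b → a ≢ b × a ∈ w × b ∈ w

Separating : {n : ℕ} → Fin n → Word n → Set
Separating c w = ∀ x y → Factor (x ∷ y ∷ []) w → x ≡ c ⊎ y ≡ c

module Submission where

-- Let xy be any factor of length 2 of w.  Order the alphabet
-- so that x is the least letter, y the second one, and all others come
-- after them; (x, <) is then an acceptable pair.  For this order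
-- min(w|1) = x and min(w|2) = x h with h ≤ y; as the former is a prefix
-- of the latter, the length 2 is admissible in the definition of min(w);
-- by maximality min(w) = x h s.  The hypothesis then forces |u| ≥ 1, and
-- comparing  x u₁ … ≤ x h s  gives  u₁ ≤ h ≤ y, i.e. u₁ ∈ {x, y}.

open import Defs
open import Data.Nat using (ℕ; _≤_; _∸_)
open import Data.Fin using (Fin)
open import Data.List using (List; []; _∷_; length; take)
open import Data.Product using (Σ; _×_)
open import Relation.Binary.PropositionalEquality using (_≡_; _≢_)

open import Data.Nat using (zero; suc; z≤n; s≤s; _<_; _≤?_)
import Data.Nat as ℕ
open import Data.Nat.Properties
  using (≤-refl; ≤-trans; ≤-pred; <⇒≤; suc-injective; ≤∧≢⇒<; m≤n⇒m≤1+n; m≤n⇒m⊓n≡m; <-irrefl; <-trans; <-cmp; allUpTo?)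
open import Data.Fin using (toℕ) renaming (_≟_ to _≟ᶠ_)
open import Data.Fin.Properties using (toℕ-injective)
open import Data.List using (_++_; drop)
open import Data.List.Properties
  using (length-take; take++drop≡id; length-++-≤ˡ; length-++-≤ʳ; ++-identityʳ; ∷-injectiveˡ)
open import Data.List.Relation.Unary.Any using (here; there)
open import Data.List.Relation.Binary.Lex.Strict using (Lex-<; base; halt; this; next; <-isStrictTotalOrder)
open import Data.List.Relation.Binary.Pointwise using (Pointwise-≡⇒≡; ≡⇒Pointwise-≡)
import Data.List.Relation.Binary.Prefix.Heterogeneous as Het
open import Data.List.Relation.Binary.Prefix.Heterogeneous.Properties using (prefix?)
open import Data.Product using (_,_; proj₁; proj₂)
open import Data.Sum using (_⊎_; inj₁; inj₂)
import Data.Sum as Sum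
open import Data.Empty using (⊥-elim)
open import Relation.Nullary using (Dec; yes; no; ¬_)
open import Relation.Nullary.Decidable using (map′; _→-dec_)
open import Relation.Unary using (Decidable)
open import Relation.Binary.PropositionalEquality using (refl; sym; trans; cong; subst; isEquivalence)
open import Relation.Binary.Structures using (IsStrictTotalOrder)
open import Relation.Binary.Definitions using (Trichotomous; tri<; tri≈; tri>)

length-take-≤ : ∀ {A : Set} k (l : List A) → k ≤ length l → length (take k l) ≡ k
length-take-≤ k l k≤l = trans (length-take k l) (m≤n⇒m⊓n≡m k≤l)

take-length-++ : ∀ {A : Set} (y s : List A) → take (length y) (y ++ s) ≡ y
take-length-++ []      s = refl
take-length-++ (x ∷ y) s = cong (x ∷_) (take-length-++ y s)

factor-length : ∀ {n} {y w : Word n} → Factor y w → length y ≤ length w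
factor-length {y = y} (p , s , refl) = ≤-trans (length-++-≤ˡ y) (length-++-≤ʳ (y ++ s) {p})

prefix-dec : ∀ {n} (p m : Word n) → Dec (Prefix p m)
prefix-dec p m = map′ fromHet toHet (prefix? _≟ᶠ_ p m)
  where
  fromHet : Het.Prefix _≡_ p m → Prefix p m
  fromHet pr with Het.toView pr
  ... | pw Het.++ s = s , cong (_++ s) (sym (Pointwise-≡⇒≡ pw))
  toHet : Prefix p m → Het.Prefix _≡_ p m
  toHet (s , refl) = Het.fromView (≡⇒Pointwise-≡ refl Het.++ s)

largestUpTo : {D : ℕ → Set} → Decidable D → D 0 → ∀ N →
  Σ ℕ λ k → k ≤ N × D k × (∀ k' → k' ≤ N → D k' → k' ≤ k)
largestUpTo D? D0 zero = 0 , z≤n , D0 , λ { _ z≤n _ → z≤n }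
largestUpTo {D} D? D0 (suc N) with D? (suc N)
... | yes DN = suc N , ≤-refl , DN , λ _ k'≤ _ → k'≤
... | no ¬DN with largestUpTo D? D0 N
...   | k , k≤N , Dk , largest = k , m≤n⇒m≤1+n k≤N , Dk , below
  where
  below : ∀ k' → k' ≤ suc N → D k' → k' ≤ k
  below k' k'≤ Dk' = largest k' (≤-pred (≤∧≢⇒< k'≤ λ { refl → ¬DN Dk' })) Dk'

module Lexicographic {n : ℕ} (_<_ : Fin n → Fin n → Set) (sto : IsStrictTotalOrder _≡_ _<_) where

  toLex : ∀ {u v} → LexLt _<_ u v → Lex-< _≡_ _<_ u v
  toLex halt     = halt
  toLex (this p) = this p
  toLex (next p) = next refl (toLex p)

  fromLex : ∀ {u v} → Lex-< _≡_ _<_ u v → LexLt _<_ u v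
  fromLex (base ())
  fromLex halt          = halt
  fromLex (this p)      = this p
  fromLex (next refl p) = next (fromLex p)

  module Lex = IsStrictTotalOrder (<-isStrictTotalOrder sto)

  ≤ₗ-trans : ∀ {u v w} → LexLe _<_ u v → LexLe _<_ v w → LexLe _<_ u w
  ≤ₗ-trans (inj₁ p) (inj₁ q)    = inj₁ (fromLex (Lex.trans (toLex p) (toLex q)))
  ≤ₗ-trans (inj₁ p) (inj₂ refl) = inj₁ p
  ≤ₗ-trans (inj₂ refl) q        = q

  ≤ₗ-antisym : ∀ {u v} → LexLe _<_ u v → LexLe _<_ v u → u ≡ v
  ≤ₗ-antisym (inj₂ u≡v) _        = u≡v
  ≤ₗ-antisym (inj₁ _) (inj₂ v≡u) = sym v≡u
  ≤ₗ-antisym (inj₁ p) (inj₁ q)   =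
    ⊥-elim (Lex.irrefl (≡⇒Pointwise-≡ refl) (Lex.trans (toLex p) (toLex q)))

  ≤ₗ-total : ∀ u v → LexLe _<_ u v ⊎ LexLe _<_ v u
  ≤ₗ-total u v with Lex.compare u v
  ... | tri< p _ _ = inj₁ (inj₁ (fromLex p))
  ... | tri≈ _ e _ = inj₁ (inj₂ (Pointwise-≡⇒≡ e))
  ... | tri> _ _ p = inj₂ (inj₁ (fromLex p))

  minFactor-unique : ∀ {w k x y} → IsMinFactor _<_ w k x → IsMinFactor _<_ w k y → x ≡ y
  minFactor-unique (lx , fx , minx) (ly , fy , miny) = ≤ₗ-antisym (minx _ ly fy) (miny _ lx fx)

  factor-∷ : ∀ {k y a} {w : Word n} → Factor y (a ∷ w) → length y ≡ k →
    y ≡ take k (a ∷ w) ⊎ Factor y w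
  factor-∷ {y = y} ([] , s , e) refl =
    inj₁ (sym (trans (cong (take (length y)) e) (take-length-++ y s)))
  factor-∷ ((_ ∷ p) , s , refl) _       = inj₂ (p , s , refl)

  factor-weaken : ∀ {y a} {w : Word n} → Factor y w → Factor y (a ∷ w)
  factor-weaken {a = a} (p , s , e) = (a ∷ p) , s , cong (a ∷_) e

  take-factor : ∀ k (w : Word n) → Factor (take k w) w
  take-factor k w = [] , drop k w , sym (take++drop≡id k w)

  minFactor : ℕ → Word n → Word n
  minFactor k [] = []
  minFactor k (a ∷ w) with k ≤? length w
  ... | no _ = take k (a ∷ w)
  ... | yes _ with ≤ₗ-total (take k (a ∷ w)) (minFactor k w)
  ...   | inj₁ _ = take k (a ∷ w)
  ...   | inj₂ _ = minFactor k w

  minFactor-∷ : ∀ {k a x} {w : Word n} → length x ≡ k → Factor x (a ∷ w) →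
    LexLe _<_ x (take k (a ∷ w)) → (∀ y → length y ≡ k → Factor y w → LexLe _<_ x y) →
    IsMinFactor _<_ (a ∷ w) k x
  minFactor-∷ {k} {a} {x} {w} lx fx x≤t x≤w = lx , fx , least
    where
    least : ∀ y → length y ≡ k → Factor y (a ∷ w) → LexLe _<_ x y
    least y ly fy with factor-∷ fy ly
    ... | inj₁ y≡t = subst (LexLe _<_ x) (sym y≡t) x≤t
    ... | inj₂ f    = x≤w y ly f

  minFactor-correct : ∀ k (w : Word n) → k ≤ length w → IsMinFactor _<_ w k (minFactor k w)
  minFactor-correct zero [] z≤n = refl , ([] , [] , refl) , λ { [] _ _ → inj₂ refl ; (_ ∷ _) () _ }
  minFactor-correct k (a ∷ w) k≤ with k ≤? length w
  ... | no k≰w =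
    minFactor-∷ (length-take-≤ k (a ∷ w) k≤) (take-factor k (a ∷ w)) (inj₂ refl)
      λ y ly f → ⊥-elim (k≰w (subst (_≤ length w) ly (factor-length f)))
  ... | yes k≤w with minFactor-correct k w k≤w | ≤ₗ-total (take k (a ∷ w)) (minFactor k w)
  ...   | _ , _ , least | inj₁ t≤x =
    minFactor-∷ (length-take-≤ k (a ∷ w) k≤) (take-factor k (a ∷ w)) (inj₂ refl)
      λ y ly f → ≤ₗ-trans t≤x (least y ly f)
  ...   | lx , fx , least | inj₂ x≤t = minFactor-∷ lx (factor-weaken fx) x≤t least

  -- The decidable form of "k is admissible": every min(w|j), 1 ≤ j ≤ k,
  -- is a prefix of min(w|k).
  Admissible : Word n → ℕ → Set
  Admissible w k = ∀ {j} → j ℕ.< suc k → 1 ≤ j → Prefix (minFactor j w) (minFactor k w)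

  admissible? : ∀ w → Decidable (Admissible w)
  admissible? w k = allUpTo? (λ j → (1 ≤? j) →-dec prefix-dec (minFactor j w) (minFactor k w)) (suc k)

  admissible⇒goodLength : ∀ {w k} → k ≤ length w → Admissible w k → GoodLength _<_ w k (minFactor k w)
  admissible⇒goodLength {w} {k} k≤w adm =
    minFactor-correct k w k≤w ,
    λ j x 1≤j j≤k isx → subst (λ z → Prefix z (minFactor k w))
      (minFactor-unique (minFactor-correct j w (≤-trans j≤k k≤w)) isx) (adm (s≤s j≤k) 1≤j)

  goodLength⇒admissible : ∀ {w k m} → k ≤ length w → GoodLength _<_ w k m → Admissible w k
  goodLength⇒admissible {w} {k} k≤w (ism , prefixes) {j} (s≤s j≤k) 1≤j =
    subst (Prefix (minFactor j w)) (minFactor-unique ism (minFactor-correct k w k≤w))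
      (prefixes j (minFactor j w) 1≤j j≤k (minFactor-correct j w (≤-trans j≤k k≤w)))

  minWord-exists : ∀ (w : Word n) → Σ (Word n) (IsMinWord _<_ w)
  minWord-exists w with largestUpTo (admissible? w) (λ { (s≤s z≤n) () }) (length w)
  ... | k , k≤w , adm , largest =
    minFactor k w , k , k≤w , admissible⇒goodLength k≤w adm ,
    λ k' m' k'≤w gl → largest k' k'≤w (goodLength⇒admissible k'≤w gl)

module AcceptablePair {n : ℕ} (_<_ : Fin n → Fin n → Set) (sto : IsStrictTotalOrder _≡_ _<_)
                      (a : Fin n) (a-least : ∀ b → a ≢ b → a < b) where
  open Lexicographic _<_ sto
  open IsStrictTotalOrder sto using (irrefl; asym) renaming (trans to <-trans′)

  _≼_ : Fin n → Fin n → Set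
  c ≼ d = c < d ⊎ c ≡ d

  ≼-trans : ∀ {c d e} → c ≼ d → d ≼ e → c ≼ e
  ≼-trans (inj₁ p) (inj₁ q)    = inj₁ (<-trans′ p q)
  ≼-trans (inj₁ p) (inj₂ refl) = inj₁ p
  ≼-trans (inj₂ refl) q        = q

  nothing-below-a : ∀ {b} → ¬ (b < a)
  nothing-below-a {b} b<a with b ≟ᶠ a
  ... | yes refl = irrefl refl b<a
  ... | no b≢a   = asym b<a (a-least b λ a≡b → b≢a (sym a≡b))

  ≤ₗ-a∷ : ∀ {h u v} → LexLe _<_ (h ∷ u) (a ∷ v) → h ≡ a × LexLe _<_ u v
  ≤ₗ-a∷ (inj₁ (this h<a)) = ⊥-elim (nothing-below-a h<a)
  ≤ₗ-a∷ (inj₁ (next p))   = refl , inj₁ p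
  ≤ₗ-a∷ (inj₂ refl)       = refl , inj₂ refl

  ≤ₗ-head : ∀ {c d u v} → LexLe _<_ (c ∷ u) (d ∷ v) → c ≼ d
  ≤ₗ-head (inj₁ (this p)) = inj₁ p
  ≤ₗ-head (inj₁ (next _)) = inj₂ refl
  ≤ₗ-head (inj₂ refl)     = inj₂ refl

  module _ {w : Word n} {y : Fin n} (ay : Factor (a ∷ y ∷ []) w) where

    a-factor : Factor (a ∷ []) w
    a-factor = proj₁ ay , y ∷ proj₁ (proj₂ ay) , proj₂ (proj₂ ay)

    minFactor₁ : ∀ {x} → IsMinFactor _<_ w 1 x → x ≡ a ∷ []
    minFactor₁ {_ ∷ []} (_ , _ , least) with ≤ₗ-a∷ (least (a ∷ []) refl a-factor)
    ... | refl , _ = refl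

    minFactor₂ : ∀ {z} → IsMinFactor _<_ w 2 z → Σ (Fin n) λ h → z ≡ a ∷ h ∷ [] × h ≼ y
    minFactor₂ {_ ∷ h ∷ []} (_ , _ , least) with ≤ₗ-a∷ (least (a ∷ y ∷ []) refl ay)
    ... | refl , h≤y = h , refl , ≤ₗ-head h≤y

    goodLength₂ : ∀ {z} → IsMinFactor _<_ w 2 z → GoodLength _<_ w 2 z
    goodLength₂ {z} isz = isz , prefix
      where
      prefix : ∀ j x → 1 ≤ j → j ≤ 2 → IsMinFactor _<_ w j x → Prefix x z
      prefix 1 x _ _ isx with minFactor₁ isx | minFactor₂ isz
      ... | refl | h , refl , _ = h ∷ [] , refl
      prefix 2 x _ _ isx with minFactor-unique isx isz
      ... | refl = [] , sym (++-identityʳ x)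
      prefix (suc (suc (suc _))) _ _ (s≤s (s≤s ())) _

    minWord-shape : ∀ {m} → IsMinWord _<_ w m →
      Σ (Fin n) λ h → Σ (Word n) λ s → m ≡ a ∷ h ∷ s × h ≼ y
    minWord-shape {m} (k , _ , (_ , prefixes) , largest) =
      shape (minFactor₂ is₂) (prefixes 2 (minFactor 2 w) (s≤s z≤n) two≤k is₂)
      where
      is₂ : IsMinFactor _<_ w 2 (minFactor 2 w)
      is₂ = minFactor-correct 2 w (factor-length ay)
      two≤k : 2 ≤ k
      two≤k = largest 2 (minFactor 2 w) (factor-length ay) (goodLength₂ is₂)
      shape : (Σ (Fin n) λ h → minFactor 2 w ≡ a ∷ h ∷ [] × h ≼ y) → Prefix (minFactor 2 w) m →
        Σ (Fin n) λ h → Σ (Word n) λ s → m ≡ a ∷ h ∷ s × h ≼ y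
      shape (h , z≡ , h≤y) (s , m≡) = h , s , trans m≡ (cong (_++ s) z≡) , h≤y

    firstLetter-≼ : ∀ u →
      (∀ m → IsMinWord _<_ w m → (length m ∸ 1 ≤ length u) × LexLe _<_ (a ∷ take (length m ∸ 1) u) m) →
      Σ (Fin n) λ c → Σ (Word n) λ u' → u ≡ c ∷ u' × c ≼ y
    firstLetter-≼ u hyp with minWord-exists w
    ... | m , ism with minWord-shape ism | hyp m ism
    ...   | h , s , refl , h≤y | |u|≥ , au≤m with u | |u|≥ | au≤m
    ...     | []     | () | _
    ...     | c ∷ u' | _  | au≤m′ = c , u' , refl , ≼-trans (≤ₗ-head (proj₂ (≤ₗ-a∷ au≤m′))) h≤y

injective⇒strictTotal : ∀ {A : Set} (f : A → ℕ) → (∀ {a b} → f a ≡ f b → a ≡ b) →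
  IsStrictTotalOrder _≡_ (λ a b → f a < f b)
injective⇒strictTotal f f-inj = record
  { isStrictPartialOrder = record
    { isEquivalence = isEquivalence
    ; irrefl        = λ { refl → <-irrefl refl }
    ; trans         = <-trans
    ; <-resp-≈      = (λ { refl p → p }) , (λ { refl p → p })
    }
  ; compare = compare
  }
  where
  compare : Trichotomous _≡_ (λ a b → f a < f b)
  compare a b with <-cmp (f a) (f b)
  ... | tri< p q r = tri< p (λ e → q (cong f e)) r
  ... | tri≈ p e r = tri≈ p (f-inj e) r
  ... | tri> p q r = tri> p (λ e → q (cong f e)) r

-- The order on letters with x least, y next, then the others: an
-- acceptable pair (x, ≺) in which only x and y lie weakly below y.
module TwoLetterOrder {n : ℕ} (x y : Fin n) where

  rank : Fin n → ℕ
  rank z with z ≟ᶠ x | z ≟ᶠ y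
  ... | yes _ | _     = 0
  ... | no _  | yes _ = 1
  ... | no _  | no _  = suc (suc (toℕ z))

  rank-injective : ∀ {c d} → rank c ≡ rank d → c ≡ d
  rank-injective {c} {d} with c ≟ᶠ x | c ≟ᶠ y | d ≟ᶠ x | d ≟ᶠ y
  ... | yes c≡x | _       | yes d≡x | _       = λ _ → trans c≡x (sym d≡x)
  ... | no _    | yes c≡y | no _    | yes d≡y = λ _ → trans c≡y (sym d≡y)
  ... | no _    | no _    | no _    | no _    = λ e → toℕ-injective (suc-injective (suc-injective e))
  ... | yes _ | _     | no _  | yes _ = λ ()
  ... | yes _ | _     | no _  | no _  = λ ()
  ... | no _  | yes _ | yes _ | _     = λ ()
  ... | no _  | yes _ | no _  | no _  = λ ()
  ... | no _  | no _  | yes _ | _     = λ ()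
  ... | no _  | no _  | no _  | yes _ = λ ()

  _≺_ : Fin n → Fin n → Set
  c ≺ d = rank c < rank d

  ≺-strictTotal : IsStrictTotalOrder _≡_ _≺_
  ≺-strictTotal = injective⇒strictTotal rank rank-injective

  x-least : ∀ b → x ≢ b → x ≺ b
  x-least b x≢b with x ≟ᶠ x | b ≟ᶠ x | b ≟ᶠ y
  ... | no x≢x | _       | _     = ⊥-elim (x≢x refl)
  ... | yes _  | yes b≡x | _     = ⊥-elim (x≢b (sym b≡x))
  ... | yes _  | no _    | yes _ = s≤s z≤n
  ... | yes _  | no _    | no _  = s≤s z≤n

  acceptable : Acceptable x _≺_
  acceptable = ≺-strictTotal , x-least

  rank-y≤1 : rank y ≤ 1
  rank-y≤1 with y ≟ᶠ x | y ≟ᶠ y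
  ... | yes _ | _      = z≤n
  ... | no _  | yes _  = ≤-refl
  ... | no _  | no y≢y = ⊥-elim (y≢y refl)

  rank≤1⇒x-or-y : ∀ c → rank c ≤ 1 → c ≡ x ⊎ c ≡ y
  rank≤1⇒x-or-y c with c ≟ᶠ x | c ≟ᶠ y
  ... | yes c≡x | _       = λ _ → inj₁ c≡x
  ... | no _    | yes c≡y = λ _ → inj₂ c≡y
  ... | no _    | no _    = λ { (s≤s ()) }

  ≼y⇒x-or-y : ∀ c → c ≺ y ⊎ c ≡ y → c ≡ x ⊎ c ≡ y
  ≼y⇒x-or-y c (inj₂ c≡y) = inj₂ c≡y
  ≼y⇒x-or-y c (inj₁ c≺y) = rank≤1⇒x-or-y c (≤-trans (<⇒≤ c≺y) rank-y≤1)

factor₂ : ∀ {n} (w : Word n) → AlphGt1 w → Σ (Fin n) λ x → Σ (Fin n) λ y → Factor (x ∷ y ∷ []) w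
factor₂ []            (_ , _ , _ , () , _)
factor₂ (_ ∷ [])      (_ , _ , a≢b , here a≡ , here b≡) = ⊥-elim (a≢b (trans a≡ (sym b≡)))
factor₂ (_ ∷ [])      (_ , _ , _ , there () , _)
factor₂ (_ ∷ [])      (_ , _ , _ , here _ , there ())
factor₂ (x ∷ y ∷ w) _ = x , y , [] , w , refl

MinWordBounded : ∀ {n} → Word n → Word n → Set₁
MinWordBounded {n} w u = (a : Fin n) (_<_ : Fin n → Fin n → Set) → Acceptable a _<_ →
  (m : Word n) → IsMinWord _<_ w m →
  (length m ∸ 1 ≤ length u) × LexLe _<_ (a ∷ take (length m ∸ 1) u) m

firstLetter-∈ : ∀ {n} (w u : Word n) → MinWordBounded w u → ∀ {x y} → Factor (x ∷ y ∷ []) w →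
  Σ (Fin n) λ c → Σ (Word n) λ u' → u ≡ c ∷ u' × (c ≡ x ⊎ c ≡ y)
firstLetter-∈ w u hyp {x} {y} xy with
  AcceptablePair.firstLetter-≼ _≺_ ≺-strictTotal x x-least xy u (hyp x _≺_ acceptable)
  where open TwoLetterOrder x y
... | c , u' , u≡cu' , c≼y = c , u' , u≡cu' , TwoLetterOrder.≼y⇒x-or-y x y c c≼y

lemma4p5 : (n : ℕ) (w u : Word n) → w ≢ [] → AlphGt1 w →
    ((a : Fin n) (_<_ : Fin n → Fin n → Set) → Acceptable a _<_ →
      (m : Word n) → IsMinWord _<_ w m →
      (length m ∸ 1 ≤ length u) × LexLe _<_ (a ∷ take (length m ∸ 1) u) m) →
    Σ (Fin n) λ c → Σ (Word n) λ u' → u ≡ c ∷ u' × Separating c w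
lemma4p5 n w u _ alph hyp with firstLetter-∈ w u hyp (proj₂ (proj₂ (factor₂ w alph)))
... | c , u' , u≡cu' , _ = c , u' , u≡cu' , separating
  where
  -- The first letter of u is the same c for every factor x y, so c ∈ {x, y}.
  separating : Separating c w
  separating x y xy with firstLetter-∈ w u hyp xy
  ... | c′ , _ , u≡c′u″ , c′∈xy with ∷-injectiveˡ (trans (sym u≡cu') u≡c′u″)
  ...   | refl = Sum.map sym sym c′∈xy
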